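{- Let $k\ge 6$ and let $G_k$ be the graph defined in the context. For integers $x,y$, there exists a $k$-$L(2,1)$-labelling $L$ of $G_k$ with $L(u)=L(v)=k$, $L(a_v)=x$, $L(a_u)=y$ if and only if $(x,y)\in\{(2,0),(0,2),(k-2,0),(0,k-2)\}$.
   Context: A $k$-$L(2,1)$-labelling of a graph is a map $L$ from its vertices to $\{0,\dots,k\}$ such that adjacent vertices get labels differing by at least $2$ and vertices at distance $2$ get distinct labels. Let $H'$ be the graph with vertices $c,d,e,f_1,\dots,f_{k-3},g,h,i$ and edges $cd,de,hg,gi$ and $gf_j,df_j$ for $j=1,\dots,k-3$. $G_k$ consists of the path $u,a_u,a_v,v$, vertices $b_1,\dots,b_{k-5}$ each adjacent to both $a_u$ and $a_v$, and, for each $i=1,\dots,k-5$, two disjoint copies of $H'$ whose vertex $c$ is joined to $b_i$. -}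

module Defs where

open import Data.Nat using (ℕ; _≤_; _∸_; _+_)
open import Data.Fin using (Fin)
open import Data.Sum using (_⊎_)
open import Relation.Binary.PropositionalEquality using (_≡_)
open import Relation.Nullary using (¬_)

data HV (k : ℕ) : Set where
  hc hd he hg hh hi : HV k
  hf : Fin (k ∸ 3) → HV k

-- Edges of H' (oriented only for bookkeeping; adjacency is symmetrised below):
-- cd, de, hg, gi, and g f_j, d f_j for every j.
data HE (k : ℕ) : HV k → HV k → Set where
  e-cd : HE k hc hd
  e-de : HE k hd he
  e-hg : HE k hh hg
  e-gi : HE k hg hi
  e-gf : (j : Fin (k ∸ 3)) → HE k hg (hf j)
  e-df : (j : Fin (k ∸ 3)) → HE k hd (hf j)

-- Vertices of G_k: u, a_u, a_v, v, b_1..b_{k-5}, and for each i and each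
-- s ∈ {0,1} a copy of H' (vertex w of copy (i , s) is  hv i s w).
data V (k : ℕ) : Set where
  u au av v : V k
  b  : Fin (k ∸ 5) → V k
  hv : Fin (k ∸ 5) → Fin 2 → HV k → V k

data E (k : ℕ) : V k → V k → Set where
  e-uau  : E k u au
  e-auav : E k au av
  e-avv  : E k av v
  e-bau  : (i : Fin (k ∸ 5)) → E k (b i) au
  e-bav  : (i : Fin (k ∸ 5)) → E k (b i) av
  e-H    : (i : Fin (k ∸ 5)) (s : Fin 2) {p q : HV k} → HE k p q → E k (hv i s p) (hv i s q)
  e-bc   : (i : Fin (k ∸ 5)) (s : Fin 2) → E k (b i) (hv i s hc)

Adj : (k : ℕ) → V k → V k → Set
Adj k x y = E k x y ⊎ E k y x

Dist2 : (k : ℕ) → V k → V k → Set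
Dist2 k x y = ¬ (x ≡ y) × ¬ Adj k x y × Σ (V k) (λ z → Adj k x z × Adj k z y)
  where open import Data.Product using (_×_; Σ)

record IsL21 (k : ℕ) (L : V k → ℕ) : Set where
  field
    range : ∀ x → L x ≤ k
    adj   : ∀ x y → Adj k x y → (2 + L x ≤ L y) ⊎ (2 + L y ≤ L x)
    dist2 : ∀ x y → Dist2 k x y → ¬ (L x ≡ L y)

-- Write k = 6 + n.  Necessity is a sequence of pigeonhole counts, all derived
-- from one counting lemma (`avoiding-count`): m distinct labels in {0,…,K}
-- that avoid r known values satisfy r + m ≤ K + 1.
--  * In each copy of H', d and g have k - 1 neighbours with pairwise distinct
--    labels, so they are labelled 0 and k (`extreme-label`); the f's then fill
--    [2, k-2], so c is labelled ≤ 1, or ≥ k - 1 with L(d) = 0 (`c-label`).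
--  * Hence every b_i avoids 0 and k, and if some b_i is labelled k - 1 then
--    a_u, a_v are labelled ≥ 2 (`b-labels`).
--  * The k - 5 distinct labels of the b's must avoid the neighbourhoods of
--    L(a_u) and L(a_v); counting these forbidden values (`Spine`) forces the
--    smaller of the two to be 0 and the larger to be 2 or k - 2.
-- Sufficiency exhibits labellings for (2,0) and (k-2,0) (`Construction`) and
-- obtains the other two by the reflection of G_k swapping u ↔ v, a_u ↔ a_v.
module Submission where

open import Defs
open import Data.Nat using (ℕ; zero; suc; _+_; _∸_; _≤_; _<_; z≤n; s≤s; _≤?_; _≟_)
open import Data.Nat.Properties
  using ( ≤-refl; ≤-trans; <-trans; <-≤-trans; <⇒≤; ≤-pred; n≤1+n; n<1+n; m≤n+m; m≤m+n
        ; 1+n≰n; <⇒≢; ≰⇒>; ≤∧≢⇒<; +-monoˡ-≤; +-monoʳ-≤; +-cancelˡ-≡ )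
open import Data.Integer using (ℤ; +_)
open import Data.Fin as Fin using (Fin; zero; suc; toℕ; fromℕ<; splitAt; join)
open import Data.Fin.Properties using (toℕ-fromℕ<; toℕ<n; toℕ-injective; injective⇒≤; join-splitAt)
open import Data.List using (List; []; _∷_; length; lookup)
open import Data.List.Relation.Unary.All as All using (All; []; _∷_)
open import Data.List.Membership.Propositional.Properties using (∈-lookup)
open import Data.Vec.Functional using (Vector) renaming (_∷_ to _◂_)
open import Data.Product using (_×_; Σ; _,_; proj₁; proj₂)
open import Data.Sum as Sum using (_⊎_; inj₁; inj₂)
open import Data.Empty using (⊥; ⊥-elim)
open import Function using (_∘_)
open import Function.Bundles using (_⇔_; mk⇔)
open import Function.Definitions using (Injective)
open import Relation.Nullary using (¬_; yes; no; contradiction)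
open import Relation.Binary.PropositionalEquality
  using (_≡_; _≢_; refl; sym; trans; cong; cong₂; subst; subst₂; ≢-sym; module ≡-Reasoning)

no-overshoot : ∀ d {a} → suc d + a ≤ a → ⊥
no-overshoot d {a} h = 1+n≰n (≤-trans (s≤s (m≤n+m a d)) h)

Far : ℕ → ℕ → Set
Far p q = (2 + p ≤ q) ⊎ (2 + q ≤ p)

far-sym : ∀ {p q} → Far p q → Far q p
far-sym = Sum.swap

far⇒≢ : ∀ {p q} → Far p q → p ≢ q
far⇒≢ (inj₁ h) = <⇒≢ (≤-trans (n≤1+n _) h)
far⇒≢ (inj₂ h) = ≢-sym (<⇒≢ (≤-trans (n≤1+n _) h))

far⇒≢suc : ∀ {p q} → Far p q → p ≢ suc q
far⇒≢suc (inj₁ h) = <⇒≢ (≤-trans (n≤1+n _) (≤-trans h (n≤1+n _)))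
far⇒≢suc (inj₂ h) = ≢-sym (<⇒≢ h)

far⇒≢pred : ∀ {p q} → Far p (suc q) → p ≢ q
far⇒≢pred (inj₁ h) = <⇒≢ (≤-pred h)
far⇒≢pred (inj₂ h) = ≢-sym (<⇒≢ (≤-trans (n≤1+n _) (≤-trans (n≤1+n _) h)))

far-from-0 : ∀ {a} → Far a 0 → 2 ≤ a
far-from-0 (inj₂ h) = h

far-from-top : ∀ {a m} → a ≤ 2 + m → Far a (2 + m) → a ≤ m
far-from-top _   (inj₁ h) = ≤-pred (≤-pred h)
far-from-top a≤ (inj₂ h) = ⊥-elim (no-overshoot 1 (≤-trans h a≤))

avoids-0-and-1 : ∀ {a c c'} → c ≤ 1 → c' ≤ 1 → c ≢ c' → a ≢ c → a ≢ c' → 2 ≤ a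
avoids-0-and-1 {suc (suc _)} _ _ _ _ _                  = s≤s (s≤s z≤n)
avoids-0-and-1 {zero} z≤n       _         _   a≢c _     = ⊥-elim (a≢c refl)
avoids-0-and-1 {zero} (s≤s z≤n) z≤n       _   _   a≢c'  = ⊥-elim (a≢c' refl)
avoids-0-and-1 {zero} (s≤s z≤n) (s≤s z≤n) c≢c' _  _     = ⊥-elim (c≢c' refl)
avoids-0-and-1 {1}    (s≤s z≤n) _         _   a≢c _     = ⊥-elim (a≢c refl)
avoids-0-and-1 {1}    z≤n       (s≤s z≤n) _   _   a≢c'  = ⊥-elim (a≢c' refl)
avoids-0-and-1 {1}    z≤n       z≤n       c≢c' _  _     = ⊥-elim (c≢c' refl)

first : ℕ → List ℕ → ℕ
first top []      = top
first _ (w ∷ _) = w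

data Ascending (top : ℕ) : List ℕ → Set where
  []   : Ascending top []
  _<∷_ : ∀ {w ws} → w < first top ws → Ascending top ws → Ascending top (w ∷ ws)

infixr 5 _<∷_

ascending-above : ∀ {a top ws} → a < first top ws → Ascending top ws → ∀ j → a < lookup ws j
ascending-above a< (w< <∷ _)   zero    = a<
ascending-above a< (w< <∷ asc) (suc j) = ascending-above (<-trans a< w<) asc j

first-≤ : ∀ {top ws} → Ascending top ws → first top ws ≤ top
first-≤ []          = ≤-refl
first-≤ (w< <∷ asc) = <⇒≤ (<-≤-trans w< (first-≤ asc))

ascending-below : ∀ {top ws} → Ascending top ws → ∀ j → lookup ws j < top
ascending-below (w< <∷ asc) zero    = <-≤-trans w< (first-≤ asc)
ascending-below (_  <∷ asc) (suc j) = ascending-below asc j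

ascending-injective : ∀ {top ws} → Ascending top ws → Injective _≡_ _≡_ (lookup ws)
ascending-injective (_  <∷ _)   {zero}  {zero}  _ = refl
ascending-injective (w< <∷ asc) {zero}  {suc j} e = contradiction e (<⇒≢ (ascending-above w< asc j))
ascending-injective (w< <∷ asc) {suc i} {zero}  e = contradiction (sym e) (<⇒≢ (ascending-above w< asc i))
ascending-injective (_  <∷ asc) {suc i} {suc j} e = cong suc (ascending-injective asc e)

avoiding-count : ∀ {m K} (f : Fin m → ℕ) {ws} → Injective _≡_ _≡_ f → Ascending (suc K) ws →
                 (∀ i → f i ≤ K) → (∀ i → All (f i ≢_) ws) → length ws + m ≤ suc K
avoiding-count {m} {K} f {ws} f-injective asc f≤ avoids = injective⇒≤ code-injective
  where
  r = length ws

  value : Fin r ⊎ Fin m → ℕ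
  value (inj₁ j) = lookup ws j
  value (inj₂ i) = f i

  value-≤ : ∀ x → value x ≤ K
  value-≤ (inj₁ j) = ≤-pred (ascending-below asc j)
  value-≤ (inj₂ i) = f≤ i

  value-injective : ∀ {x y} → value x ≡ value y → x ≡ y
  value-injective {inj₁ j} {inj₁ j'} e = cong inj₁ (ascending-injective asc e)
  value-injective {inj₁ j} {inj₂ i}  e = contradiction (sym e) (All.lookup (avoids i) (∈-lookup j))
  value-injective {inj₂ i} {inj₁ j}  e = contradiction e (All.lookup (avoids i) (∈-lookup j))
  value-injective {inj₂ i} {inj₂ i'} e = cong inj₂ (f-injective e)

  code : Fin (r + m) → Fin (suc K)
  code x = fromℕ< (s≤s (value-≤ (splitAt r x)))

  code-injective : Injective _≡_ _≡_ code
  code-injective {x} {y} e = begin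
    x                        ≡⟨ sym (join-splitAt r m x) ⟩
    join r m (splitAt r x)   ≡⟨ cong (join r m) (value-injective {splitAt r x} {splitAt r y} same-value) ⟩
    join r m (splitAt r y)   ≡⟨ join-splitAt r m y ⟩
    y                        ∎
    where
    open ≡-Reasoning
    same-value : value (splitAt r x) ≡ value (splitAt r y)
    same-value = trans (sym (toℕ-fromℕ< _)) (trans (cong toℕ e) (toℕ-fromℕ< _))

-- A label ℓ ≤ m + 1 that is far from m distinct labels in {0, …, m + 1} is
-- 0 or m + 1: otherwise ℓ - 1, ℓ, ℓ + 1 are three further excluded values.
extreme-label : ∀ {m ℓ} (f : Fin m → ℕ) → Injective _≡_ _≡_ f → (∀ i → f i ≤ suc m) →
                (∀ i → Far (f i) ℓ) → ℓ ≤ suc m → ℓ ≡ 0 ⊎ ℓ ≡ suc m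
extreme-label {ℓ = zero} _ _ _ _ _ = inj₁ refl
extreme-label {m} {suc d} f f-injective f≤ far ℓ≤ with d ≟ m
... | yes refl = inj₂ refl
... | no d≢m   = ⊥-elim (no-overshoot 0 (avoiding-count f f-injective asc f≤ avoids))
  where
  asc : Ascending (2 + m) (d ∷ suc d ∷ suc (suc d) ∷ [])
  asc = n<1+n _ <∷ n<1+n _ <∷ s≤s (s≤s (≤∧≢⇒< (≤-pred ℓ≤) d≢m)) <∷ []
  avoids : ∀ i → All (f i ≢_) (d ∷ suc d ∷ suc (suc d) ∷ [])
  avoids i = far⇒≢pred (far i) ∷ far⇒≢ (far i) ∷ far⇒≢suc (far i) ∷ []

interval-overfull : ∀ {m} (f : Fin (suc m) → ℕ) → Injective _≡_ _≡_ f →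
                    (∀ i → 2 ≤ f i) → (∀ i → f i ≤ suc m) → ⊥
interval-overfull {m} f f-injective 2≤ ≤m = no-overshoot 0 (avoiding-count f f-injective asc f≤ avoids)
  where
  asc : Ascending (3 + m) (0 ∷ 1 ∷ 2 + m ∷ [])
  asc = s≤s z≤n <∷ s≤s (s≤s z≤n) <∷ ≤-refl <∷ []
  f≤ : ∀ i → f i ≤ 2 + m
  f≤ i = ≤-trans (≤m i) (n≤1+n _)
  avoids : ∀ i → All (f i ≢_) (0 ∷ 1 ∷ 2 + m ∷ [])
  avoids i = ≢-sym (<⇒≢ (<-trans (s≤s z≤n) (2≤ i))) ∷ ≢-sym (<⇒≢ (2≤ i)) ∷ <⇒≢ (s≤s (≤m i)) ∷ []

module Labelling {k : ℕ} {L : V k → ℕ} (P : IsL21 k L) where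
  open IsL21 P

  -- Distinct vertices with a common neighbour get distinct labels: if they
  -- are adjacent their labels differ by 2, otherwise they are at distance 2.
  common-neighbour : ∀ {x y z} → x ≢ y → Adj k x z → Adj k z y → L x ≢ L y
  common-neighbour {x} {y} {z} x≢y xz zy Lx≡Ly = dist2 x y (x≢y , not-adjacent , z , xz , zy) Lx≡Ly
    where
    not-adjacent : ¬ Adj k x y
    not-adjacent xy = far⇒≢ (adj x y xy) Lx≡Ly

  neighbour-labels-injective : ∀ {m z} (nb : Fin m → V k) → (∀ a → Adj k (nb a) z) →
                               Injective _≡_ _≡_ nb → Injective _≡_ _≡_ (L ∘ nb)
  neighbour-labels-injective nb nb-z nb-injective {a} {a'} e with a Fin.≟ a'
  ... | yes a≡a' = a≡a'
  ... | no a≢a'  = contradiction e (common-neighbour (a≢a' ∘ nb-injective) (nb-z a) (Sum.swap (nb-z a')))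

◂-injective : ∀ {A : Set} {m} {x : A} {xs : Vector A m} →
              (∀ j → x ≢ xs j) → Injective _≡_ _≡_ xs → Injective _≡_ _≡_ (x ◂ xs)
◂-injective fresh xs-injective {zero}  {zero}  _ = refl
◂-injective fresh xs-injective {zero}  {suc j} e = contradiction e (fresh j)
◂-injective fresh xs-injective {suc i} {zero}  e = contradiction (sym e) (fresh i)
◂-injective fresh xs-injective {suc i} {suc j} e = cong suc (xs-injective e)

-- What a labelling forces on the labels B of b₁, …, b_{k-5}, where p and q
-- are the labels of a_u and a_v in some order and k = 6 + n.
record BLabels (n : ℕ) (B : Fin (1 + n) → ℕ) (p q : ℕ) : Set where
  field
    injective : Injective _≡_ _≡_ B
    bounded   : ∀ i → B i ≤ 6 + n
    nonzero   : ∀ i → B i ≢ 0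
    not-top   : ∀ i → B i ≢ 6 + n
    far-p     : ∀ i → Far (B i) p
    far-q     : ∀ i → Far (B i) q
    second-top-forces : ∀ i → B i ≡ 5 + n → 2 ≤ p

module Necessity (n : ℕ) {L : V (6 + n) → ℕ} (P : IsL21 (6 + n) L) where
  open IsL21 P
  open Labelling P

  module Gadget (i : Fin (1 + n)) (s : Fin 2) where
    c d g : V (6 + n)
    c = hv i s hc
    d = hv i s hd
    g = hv i s hg

    fs : Fin (3 + n) → V (6 + n)
    fs j = hv i s (hf j)

    fs-injective : Injective _≡_ _≡_ fs
    fs-injective refl = refl

    -- d has the k - 1 neighbours e, c, f₁, …, f_{k-3}; g has h, i, f₁, …
    c-and-fs : Fin (4 + n) → V (6 + n)
    c-and-fs = c ◂ fs

    d-neighbours g-neighbours : Fin (5 + n) → V (6 + n)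
    d-neighbours = hv i s he ◂ c-and-fs
    g-neighbours = hv i s hh ◂ (hv i s hi ◂ fs)

    c-and-fs-adjacent : ∀ a → Adj (6 + n) (c-and-fs a) d
    c-and-fs-adjacent zero    = inj₁ (e-H i s e-cd)
    c-and-fs-adjacent (suc j) = inj₂ (e-H i s (e-df j))

    d-neighbours-adjacent : ∀ a → Adj (6 + n) (d-neighbours a) d
    d-neighbours-adjacent zero    = inj₂ (e-H i s e-de)
    d-neighbours-adjacent (suc a) = c-and-fs-adjacent a

    g-neighbours-adjacent : ∀ a → Adj (6 + n) (g-neighbours a) g
    g-neighbours-adjacent zero          = inj₁ (e-H i s e-hg)
    g-neighbours-adjacent (suc zero)    = inj₂ (e-H i s e-gi)
    g-neighbours-adjacent (suc (suc j)) = inj₂ (e-H i s (e-gf j))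

    c-and-fs-labels-injective : Injective _≡_ _≡_ (L ∘ c-and-fs)
    c-and-fs-labels-injective = neighbour-labels-injective c-and-fs c-and-fs-adjacent
      (◂-injective (λ _ ()) fs-injective)

    -- A vertex with k - 1 neighbours is labelled 0 or k.
    d-extreme : L d ≡ 0 ⊎ L d ≡ 6 + n
    d-extreme = extreme-label (L ∘ d-neighbours)
      (neighbour-labels-injective d-neighbours d-neighbours-adjacent
        (◂-injective (λ { zero () ; (suc _) () }) (◂-injective (λ _ ()) fs-injective)))
      (range ∘ d-neighbours) (λ a → adj _ _ (d-neighbours-adjacent a)) (range d)

    g-extreme : L g ≡ 0 ⊎ L g ≡ 6 + n
    g-extreme = extreme-label (L ∘ g-neighbours)
      (neighbour-labels-injective g-neighbours g-neighbours-adjacent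
        (◂-injective (λ { zero () ; (suc _) () }) (◂-injective (λ _ ()) fs-injective)))
      (range ∘ g-neighbours) (λ a → adj _ _ (g-neighbours-adjacent a)) (range g)

    -- d and g share the neighbour f₁, so one is labelled 0 and the other k.
    d≢g : L d ≢ L g
    d≢g = common-neighbour (λ ()) (inj₁ (e-H i s (e-df zero))) (inj₂ (e-H i s (e-gf zero)))

    d-g-extremes : (L d ≡ 0 × L g ≡ 6 + n) ⊎ (L d ≡ 6 + n × L g ≡ 0)
    d-g-extremes with d-extreme | g-extreme
    ... | inj₁ d≡0 | inj₂ g≡k = inj₁ (d≡0 , g≡k)
    ... | inj₂ d≡k | inj₁ g≡0 = inj₂ (d≡k , g≡0)
    ... | inj₁ d≡0 | inj₁ g≡0 = ⊥-elim (d≢g (trans d≡0 (sym g≡0)))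
    ... | inj₂ d≡k | inj₂ g≡k = ⊥-elim (d≢g (trans d≡k (sym g≡k)))

    f-d : ∀ j → Far (L (fs j)) (L d)
    f-d j = adj _ _ (inj₂ (e-H i s (e-df j)))

    f-g : ∀ j → Far (L (fs j)) (L g)
    f-g j = adj _ _ (inj₂ (e-H i s (e-gf j)))

    -- Each f_j is adjacent to both d and g, hence far from 0 and from k.
    fs-middle : ∀ j → 2 ≤ L (fs j) × L (fs j) ≤ 4 + n
    fs-middle j with d-g-extremes
    ... | inj₁ (d≡0 , g≡k) = far-from-0 (subst (Far _) d≡0 (f-d j)) , far-from-top (range _) (subst (Far _) g≡k (f-g j))
    ... | inj₂ (d≡k , g≡0) = far-from-0 (subst (Far _) g≡0 (f-g j)) , far-from-top (range _) (subst (Far _) d≡k (f-d j))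

    -- The k - 3 labels of the f's fill [2, k - 2], leaving no room for c.
    c-not-middle : 2 ≤ L c → L c ≤ 4 + n → ⊥
    c-not-middle 2≤c c≤ = interval-overfull (L ∘ c-and-fs) c-and-fs-labels-injective lower upper
      where
      lower : ∀ a → 2 ≤ L (c-and-fs a)
      lower zero    = 2≤c
      lower (suc j) = proj₁ (fs-middle j)
      upper : ∀ a → L (c-and-fs a) ≤ 4 + n
      upper zero    = c≤
      upper (suc j) = proj₂ (fs-middle j)

    c-d : Far (L c) (L d)
    c-d = adj _ _ (inj₁ (e-H i s e-cd))

    -- Hence c is labelled 0 or 1 (when d is labelled k), or at least k - 1
    -- (when d is labelled 0): c must be far from d but outside [2, k - 2].
    c-label : L c ≤ 1 ⊎ (5 + n ≤ L c × L d ≡ 0)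
    c-label with d-extreme | 2 ≤? L c | L c ≤? 4 + n
    ... | inj₁ d≡0 | _       | yes c≤ = ⊥-elim (c-not-middle (far-from-0 (subst (Far _) d≡0 c-d)) c≤)
    ... | inj₁ d≡0 | _       | no c≰  = inj₂ (≰⇒> c≰ , d≡0)
    ... | inj₂ d≡k | yes 2≤c | _      = ⊥-elim (c-not-middle 2≤c (far-from-top (range c) (subst (Far _) d≡k c-d)))
    ... | inj₂ d≡k | no 2≰c  | _      = inj₁ (≤-pred (≰⇒> 2≰c))

  open Gadget using (c-label)

  -- No b_i is labelled 0: either its neighbour c is labelled 0 or 1, or the
  -- d at distance 2 from b_i is labelled 0.
  b-nonzero : ∀ i → L (b i) ≢ 0
  b-nonzero i b≡0 with c-label i zero
  ... | inj₁ c≤1       = 1+n≰n (≤-trans (far-from-0 (far-sym (subst (λ w → Far w (L (hv i zero hc))) b≡0 b-c))) c≤1)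
    where
    b-c : Far (L (b i)) (L (hv i zero hc))
    b-c = adj _ _ (inj₁ (e-bc i zero))
  ... | inj₂ (_ , d≡0) = common-neighbour (λ ()) (inj₁ (e-bc i zero)) (inj₁ (e-H i zero e-cd)) (trans b≡0 (sym d≡0))

  c-low : ∀ i s → L (b i) ≡ 5 + n → L (hv i s hc) ≤ 1
  c-low i s b≡ with c-label i s | subst (λ w → Far w (L (hv i s hc))) b≡ (adj _ _ (inj₁ (e-bc i s)))
  ... | inj₁ c≤1       | _        = c≤1
  ... | inj₂ (c≥ , _)  | inj₁ b-c = ⊥-elim (no-overshoot 0 (≤-trans b-c (range _)))
  ... | inj₂ (c≥ , _)  | inj₂ c-b = ⊥-elim (no-overshoot 1 (≤-trans c-b c≥))

  -- Then every vertex a adjacent to b_i, other than those c's, avoids both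
  -- labels of the c's and so is labelled at least 2.
  above-one : ∀ i {a} → Adj (6 + n) a (b i) → (∀ s → a ≢ hv i s hc) → L (b i) ≡ 5 + n → 2 ≤ L a
  above-one i a-b a≢c b≡ = avoids-0-and-1 (c-low i zero b≡) (c-low i (suc zero) b≡) c₀≢c₁
    (common-neighbour (a≢c zero) a-b (inj₁ (e-bc i zero)))
    (common-neighbour (a≢c (suc zero)) a-b (inj₁ (e-bc i (suc zero))))
    where
    c₀≢c₁ : L (hv i zero hc) ≢ L (hv i (suc zero) hc)
    c₀≢c₁ = common-neighbour (λ ()) (inj₂ (e-bc i zero)) (inj₁ (e-bc i (suc zero)))

  b-labels : L u ≡ 6 + n → ∀ {a a'} → (∀ i → Adj (6 + n) (b i) a) → (∀ i → Adj (6 + n) (b i) a') →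
             (∀ i s → a ≢ hv i s hc) → BLabels n (L ∘ b) (L a) (L a')
  b-labels Lu b-a b-a' a≢c = record
    { injective         = neighbour-labels-injective b (λ i → inj₁ (e-bau i)) λ { refl → refl }
    ; bounded           = range ∘ b
    ; nonzero           = b-nonzero
    ; not-top           = λ i b≡k → common-neighbour (λ ()) (inj₁ (e-bau i)) (inj₂ e-uau) (trans b≡k (sym Lu))
    ; far-p             = λ i → adj _ _ (b-a i)
    ; far-q             = λ i → adj _ _ (b-a' i)
    ; second-top-forces = λ i → above-one i (Sum.swap (b-a i)) (a≢c i)
    }

module Spine {n : ℕ} {B : Fin (1 + n) → ℕ} where

  seven-excluded : ∀ {p q ws} → BLabels n B p q → Ascending (7 + n) ws → 7 ≤ length ws →
                   (∀ i → All (B i ≢_) ws) → ⊥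
  seven-excluded H asc 7≤ avoids = no-overshoot 0
    (≤-trans (+-monoˡ-≤ (1 + n) 7≤) (avoiding-count B injective asc bounded avoids))
    where open BLabels H

  -- p ≥ 2 excludes 0, p - 1, p, p + 1, q, q + 1 and k.
  low-label-large : ∀ {p q} → BLabels n B (2 + p) q → 4 + p ≤ q → q ≤ 4 + n → ⊥
  low-label-large {p} {q} H p<q q≤ = seven-excluded H asc ≤-refl λ i →
    nonzero i ∷ far⇒≢pred (far-p i) ∷ far⇒≢ (far-p i) ∷ far⇒≢suc (far-p i) ∷
    far⇒≢ (far-q i) ∷ far⇒≢suc (far-q i) ∷ not-top i ∷ []
    where
    open BLabels H
    asc : Ascending (7 + n) (0 ∷ 1 + p ∷ 2 + p ∷ 3 + p ∷ q ∷ 1 + q ∷ 6 + n ∷ [])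
    asc = s≤s z≤n <∷ n<1+n _ <∷ n<1+n _ <∷ p<q <∷ n<1+n _ <∷ s≤s (s≤s q≤) <∷ n<1+n _ <∷ []

  -- p = 1 excludes 0, 1, 2, q, q + 1, k, and q - 1 (if q ≥ 4) or k - 1 (if q = 3).
  low-label-not-one : ∀ {q} → BLabels n B 1 q → 3 ≤ q → q ≤ 4 + n → ⊥
  low-label-not-one {1} _ (s≤s ()) _
  low-label-not-one {2} _ (s≤s (s≤s ())) _
  low-label-not-one {3} H _ _ = seven-excluded H asc ≤-refl λ i →
    nonzero i ∷ far⇒≢ (far-p i) ∷ far⇒≢suc (far-p i) ∷ far⇒≢ (far-q i) ∷ far⇒≢suc (far-q i) ∷
    (λ b≡ → 1+n≰n (second-top-forces i b≡)) ∷ not-top i ∷ []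
    where
    open BLabels H
    asc : Ascending (7 + n) (0 ∷ 1 ∷ 2 ∷ 3 ∷ 4 ∷ 5 + n ∷ 6 + n ∷ [])
    asc = s≤s z≤n <∷ n<1+n _ <∷ n<1+n _ <∷ n<1+n _ <∷ s≤s (m≤m+n 4 n) <∷ n<1+n _ <∷ n<1+n _ <∷ []
  low-label-not-one {suc (suc (suc (suc q)))} H _ q≤ = seven-excluded H asc ≤-refl λ i →
    nonzero i ∷ far⇒≢ (far-p i) ∷ far⇒≢suc (far-p i) ∷ far⇒≢pred (far-q i) ∷ far⇒≢ (far-q i) ∷
    far⇒≢suc (far-q i) ∷ not-top i ∷ []
    where
    open BLabels H
    asc : Ascending (7 + n) (0 ∷ 1 ∷ 2 ∷ 3 + q ∷ 4 + q ∷ 5 + q ∷ 6 + n ∷ [])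
    asc = s≤s z≤n <∷ n<1+n _ <∷ s≤s (m≤m+n 2 q) <∷ n<1+n _ <∷ n<1+n _ <∷ s≤s (s≤s q≤) <∷ n<1+n _ <∷ []

  -- p = 0 excludes 0, 1, q - 1, q, q + 1, k - 1, k: distinct unless q = 2 or q = k - 2.
  high-label-extreme : ∀ {q} → BLabels n B 0 q → 2 ≤ q → q ≤ 4 + n → q ≡ 2 ⊎ q ≡ 4 + n
  high-label-extreme {1} _ (s≤s ()) _
  high-label-extreme {2} _ _ _ = inj₁ refl
  high-label-extreme {suc (suc (suc q))} H _ q≤ with q ≟ 1 + n
  ... | yes refl = inj₂ refl
  ... | no q≢    = ⊥-elim (seven-excluded H asc ≤-refl λ i →
    nonzero i ∷ far⇒≢suc (far-p i) ∷ far⇒≢pred (far-q i) ∷ far⇒≢ (far-q i) ∷ far⇒≢suc (far-q i) ∷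
    (λ b≡ → contradiction (second-top-forces i b≡) λ ()) ∷ not-top i ∷ [])
    where
    open BLabels H
    q≤n : q ≤ n
    q≤n = ≤-pred (≤∧≢⇒< (≤-pred (≤-pred (≤-pred q≤))) q≢)
    asc : Ascending (7 + n) (0 ∷ 1 ∷ 2 + q ∷ 3 + q ∷ 4 + q ∷ 5 + n ∷ 6 + n ∷ [])
    asc = s≤s z≤n <∷ s≤s (s≤s z≤n) <∷ n<1+n _ <∷ n<1+n _ <∷ +-monoʳ-≤ 5 q≤n <∷ n<1+n _ <∷ n<1+n _ <∷ []

  spine-labels : ∀ {p q} → BLabels n B p q → 2 + p ≤ q → q ≤ 4 + n → p ≡ 0 × (q ≡ 2 ⊎ q ≡ 4 + n)
  spine-labels {0}             H 2≤q q≤ = refl , high-label-extreme H 2≤q q≤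
  spine-labels {1}             H 3≤q q≤ = ⊥-elim (low-label-not-one H 3≤q q≤)
  spine-labels {suc (suc p)}   H p<q q≤ = ⊥-elim (low-label-large H p<q q≤)

necessity : ∀ n {L} → IsL21 (6 + n) L → L u ≡ 6 + n → L v ≡ 6 + n →
            (L au ≡ 0 × (L av ≡ 2 ⊎ L av ≡ 4 + n)) ⊎ (L av ≡ 0 × (L au ≡ 2 ⊎ L au ≡ 4 + n))
necessity n {L} P Lu Lv = by-order (adj au av (inj₁ e-auav))
  where
  open IsL21 P
  open Necessity n P

  av≤ : L av ≤ 4 + n
  av≤ = far-from-top (range av) (subst (Far _) Lv (adj av v (inj₁ e-avv)))

  au≤ : L au ≤ 4 + n
  au≤ = far-from-top (range au) (subst (Far _) Lu (adj au u (inj₂ e-uau)))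

  by-order : Far (L au) (L av) →
             (L au ≡ 0 × (L av ≡ 2 ⊎ L av ≡ 4 + n)) ⊎ (L av ≡ 0 × (L au ≡ 2 ⊎ L au ≡ 4 + n))
  by-order (inj₁ au<av) = inj₁ (Spine.spine-labels
    (b-labels Lu (λ i → inj₁ (e-bau i)) (λ i → inj₁ (e-bav i)) (λ _ _ ())) au<av av≤)
  by-order (inj₂ av<au) = inj₂ (Spine.spine-labels
    (b-labels Lu (λ i → inj₁ (e-bav i)) (λ i → inj₁ (e-bau i)) (λ _ _ ())) av<au au≤)

reflect : ∀ {k} → V k → V k
reflect u          = v
reflect v          = u
reflect au         = av
reflect av         = au
reflect (b i)      = b i
reflect (hv i s p) = hv i s p

reflect-involutive : ∀ {k} (x : V k) → reflect (reflect x) ≡ x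
reflect-involutive u          = refl
reflect-involutive v          = refl
reflect-involutive au         = refl
reflect-involutive av         = refl
reflect-involutive (b i)      = refl
reflect-involutive (hv i s p) = refl

reflect-edge : ∀ {k x y} → E k x y → Adj k (reflect x) (reflect y)
reflect-edge e-uau       = inj₂ e-avv
reflect-edge e-auav      = inj₂ e-auav
reflect-edge e-avv       = inj₂ e-uau
reflect-edge (e-bau i)   = inj₁ (e-bav i)
reflect-edge (e-bav i)   = inj₁ (e-bau i)
reflect-edge (e-H i s h) = inj₁ (e-H i s h)
reflect-edge (e-bc i s)  = inj₁ (e-bc i s)

reflect-adj : ∀ {k x y} → Adj k x y → Adj k (reflect x) (reflect y)
reflect-adj (inj₁ xy) = reflect-edge xy
reflect-adj (inj₂ yx) = Sum.swap (reflect-edge yx)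

reflect-labelling : ∀ {k L} → IsL21 k L → IsL21 k (L ∘ reflect)
reflect-labelling {k} {L} P = record
  { range = range ∘ reflect
  ; adj   = λ x y xy → adj _ _ (reflect-adj xy)
  ; dist2 = λ { x y (x≢y , ¬xy , z , xz , zy) →
      dist2 (reflect x) (reflect y) (x≢y ∘ reflect-injective , ¬xy ∘ reflect-back , reflect z , reflect-adj xz , reflect-adj zy) }
  }
  where
  open IsL21 P
  reflect-injective : ∀ {x y} → reflect {k} x ≡ reflect y → x ≡ y
  reflect-injective {x} {y} e = trans (sym (reflect-involutive x)) (trans (cong reflect e) (reflect-involutive y))
  reflect-back : ∀ {x y} → Adj k (reflect x) (reflect y) → Adj k x y
  reflect-back {x} {y} a = subst₂ (Adj k) (reflect-involutive x) (reflect-involutive y) (reflect-adj a)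

Realises : ℕ → ℕ → ℕ → Set
Realises n X Y = Σ (V (6 + n) → ℕ) λ L → IsL21 (6 + n) L × L u ≡ 6 + n × L v ≡ 6 + n × L av ≡ X × L au ≡ Y

realises-reflect : ∀ {n X Y} → Realises n X Y → Realises n Y X
realises-reflect (L , P , Lu , Lv , Lav , Lau) = L ∘ reflect , reflect-labelling P , Lv , Lu , Lau , Lav

module Construction (n : ℕ) where

  -- Outside the interval [2, k - 2] there are two labels on the low side
  -- (0 and 1) and two on the high side (k and k - 1).
  data Side : Set where
    low high : Side

  data Position : Set where
    extreme inner : Position

  opposite : Side → Side
  opposite low  = high
  opposite high = low

  other : Position → Position
  other extreme = inner
  other inner   = extreme

  outer : Side → Position → ℕ
  outer low  extreme = 0
  outer low  inner   = 1
  outer high extreme = 6 + n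
  outer high inner   = 5 + n

  outer-range : ∀ s x → outer s x ≤ 6 + n
  outer-range low  extreme = z≤n
  outer-range low  inner   = s≤s z≤n
  outer-range high extreme = ≤-refl
  outer-range high inner   = n≤1+n _

  outer-far : ∀ s x y → Far (outer s x) (outer (opposite s) y)
  outer-far low  extreme extreme = inj₁ (s≤s (s≤s z≤n))
  outer-far low  extreme inner   = inj₁ (s≤s (s≤s z≤n))
  outer-far low  inner   extreme = inj₁ (s≤s (s≤s (s≤s z≤n)))
  outer-far low  inner   inner   = inj₁ (s≤s (s≤s (s≤s z≤n)))
  outer-far high extreme extreme = inj₂ (s≤s (s≤s z≤n))
  outer-far high extreme inner   = inj₂ (s≤s (s≤s (s≤s z≤n)))
  outer-far high inner   extreme = inj₂ (s≤s (s≤s z≤n))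
  outer-far high inner   inner   = inj₂ (s≤s (s≤s (s≤s z≤n)))

  outer-other : ∀ s x → outer s x ≢ outer s (other x)
  outer-other low  extreme = λ ()
  outer-other low  inner   = λ ()
  outer-other high extreme = ≢-sym (<⇒≢ ≤-refl)
  outer-other high inner   = <⇒≢ ≤-refl

  f-label : Fin (3 + n) → ℕ
  f-label j = 2 + toℕ j

  f-label-lower : ∀ j → 2 ≤ f-label j
  f-label-lower _ = s≤s (s≤s z≤n)

  f-label-upper : ∀ j → f-label j ≤ 4 + n
  f-label-upper j = s≤s (s≤s (≤-pred (toℕ<n j)))

  f≢outer : ∀ j s x → f-label j ≢ outer s x
  f≢outer j low  extreme = λ ()
  f≢outer j low  inner   = λ ()
  f≢outer j high extreme = <⇒≢ (s≤s (≤-trans (f-label-upper j) (n≤1+n _)))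
  f≢outer j high inner   = <⇒≢ (s≤s (f-label-upper j))

  f-far-extreme : ∀ j s → Far (f-label j) (outer s extreme)
  f-far-extreme j low  = inj₂ (f-label-lower j)
  f-far-extreme j high = inj₁ (s≤s (s≤s (f-label-upper j)))

  gadget : Side → Position → HV (6 + n) → ℕ
  gadget s x hc     = outer (opposite s) x
  gadget s x hd     = outer s extreme
  gadget s x he     = outer (opposite s) (other x)
  gadget s x hg     = outer (opposite s) extreme
  gadget s x hh     = outer s extreme
  gadget s x hi     = outer s inner
  gadget s x (hf j) = f-label j

  gadget-range : ∀ s x p → gadget s x p ≤ 6 + n
  gadget-range s x hc     = outer-range (opposite s) x
  gadget-range s x hd     = outer-range s extreme
  gadget-range s x he     = outer-range (opposite s) (other x)
  gadget-range s x hg     = outer-range (opposite s) extreme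
  gadget-range s x hh     = outer-range s extreme
  gadget-range s x hi     = outer-range s inner
  gadget-range s x (hf j) = ≤-trans (f-label-upper j) (≤-trans (n≤1+n _) (n≤1+n _))

  gadget-far : ∀ s x {p q} → HE (6 + n) p q → Far (gadget s x p) (gadget s x q)
  gadget-far s x e-cd     = far-sym (outer-far s extreme x)
  gadget-far s x e-de     = outer-far s extreme (other x)
  gadget-far s x e-hg     = outer-far s extreme extreme
  gadget-far s x e-gi     = far-sym (outer-far s inner extreme)
  gadget-far s x (e-gf j) = far-sym (f-far-extreme j (opposite s))
  gadget-far s x (e-df j) = far-sym (f-far-extreme j s)

  f-vertices-equal : ∀ {j j'} → f-label j ≡ f-label j' → hf {6 + n} j ≡ hf j'
  f-vertices-equal e = cong hf (toℕ-injective (cong (_∸ 2) e))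

  HAdj : HV (6 + n) → HV (6 + n) → Set
  HAdj p q = HE (6 + n) p q ⊎ HE (6 + n) q p

  gadget-distinct : ∀ s x {p z q} → p ≢ q → HAdj p z → HAdj z q → gadget s x p ≢ gadget s x q
  gadget-distinct s x p≢q (inj₁ e-cd)     (inj₁ e-de)      = outer-other (opposite s) x
  gadget-distinct s x p≢q (inj₂ e-de)     (inj₂ e-cd)      = ≢-sym (outer-other (opposite s) x)
  gadget-distinct s x p≢q (inj₁ e-cd)     (inj₁ (e-df j))  = ≢-sym (f≢outer j (opposite s) x)
  gadget-distinct s x p≢q (inj₂ e-de)     (inj₁ (e-df j))  = ≢-sym (f≢outer j (opposite s) (other x))
  gadget-distinct s x p≢q (inj₂ (e-df j)) (inj₂ e-cd)      = f≢outer j (opposite s) x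
  gadget-distinct s x p≢q (inj₂ (e-df j)) (inj₁ e-de)      = f≢outer j (opposite s) (other x)
  gadget-distinct s x p≢q (inj₂ (e-df j)) (inj₁ (e-df j')) = p≢q ∘ f-vertices-equal
  gadget-distinct s x p≢q (inj₁ e-hg)     (inj₁ e-gi)      = outer-other s extreme
  gadget-distinct s x p≢q (inj₂ e-gi)     (inj₂ e-hg)      = ≢-sym (outer-other s extreme)
  gadget-distinct s x p≢q (inj₁ e-hg)     (inj₁ (e-gf j))  = ≢-sym (f≢outer j s extreme)
  gadget-distinct s x p≢q (inj₂ e-gi)     (inj₁ (e-gf j))  = ≢-sym (f≢outer j s inner)
  gadget-distinct s x p≢q (inj₂ (e-gf j)) (inj₂ e-hg)      = f≢outer j s extreme
  gadget-distinct s x p≢q (inj₂ (e-gf j)) (inj₁ e-gi)      = f≢outer j s inner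
  gadget-distinct s x p≢q (inj₂ (e-gf j)) (inj₁ (e-gf j')) = p≢q ∘ f-vertices-equal
  gadget-distinct s x p≢q (inj₁ (e-df j)) (inj₂ (e-gf _))  = far⇒≢ (outer-far s extreme extreme)
  gadget-distinct s x p≢q (inj₁ (e-gf j)) (inj₂ (e-df _))  = ≢-sym (far⇒≢ (outer-far s extreme extreme))
  gadget-distinct s x p≢q (inj₁ e-cd)     (inj₂ e-cd)      = ⊥-elim (p≢q refl)
  gadget-distinct s x p≢q (inj₂ e-cd)     (inj₁ e-cd)      = ⊥-elim (p≢q refl)
  gadget-distinct s x p≢q (inj₁ e-de)     (inj₂ e-de)      = ⊥-elim (p≢q refl)
  gadget-distinct s x p≢q (inj₂ e-de)     (inj₁ e-de)      = ⊥-elim (p≢q refl)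
  gadget-distinct s x p≢q (inj₁ e-hg)     (inj₂ e-hg)      = ⊥-elim (p≢q refl)
  gadget-distinct s x p≢q (inj₂ e-hg)     (inj₁ e-hg)      = ⊥-elim (p≢q refl)
  gadget-distinct s x p≢q (inj₁ e-gi)     (inj₂ e-gi)      = ⊥-elim (p≢q refl)
  gadget-distinct s x p≢q (inj₂ e-gi)     (inj₁ e-gi)      = ⊥-elim (p≢q refl)
  gadget-distinct s x p≢q (inj₁ (e-gf j)) (inj₂ (e-gf _))  = ⊥-elim (p≢q refl)
  gadget-distinct s x p≢q (inj₁ (e-df j)) (inj₂ (e-df _))  = ⊥-elim (p≢q refl)

  module Labelled (X Y o : ℕ) (side : Fin 2 → Side) (position : Fin 2 → Position) where
    c-label : Fin 2 → ℕ
    c-label s = outer (opposite (side s)) (position s)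

    labelling : V (6 + n) → ℕ
    labelling u          = 6 + n
    labelling v          = 6 + n
    labelling au         = Y
    labelling av         = X
    labelling (b i)      = o + toℕ i
    labelling (hv i s p) = gadget (side s) (position s) p

    -- The conditions left to check, on the parameters only.
    record Valid : Set where
      field
        X-range    : X ≤ 6 + n
        Y-range    : Y ≤ 6 + n
        o-positive : 1 ≤ o
        o-room     : o + n < 6 + n
        far-u-au   : Far (6 + n) Y
        far-au-av  : Far Y X
        far-av-v   : Far X (6 + n)
        far-b-au   : ∀ (i : Fin (1 + n)) → Far (o + toℕ i) Y
        far-b-av   : ∀ (i : Fin (1 + n)) → Far (o + toℕ i) X
        far-b-c    : ∀ (i : Fin (1 + n)) s → Far (o + toℕ i) (c-label s)
        au≢c       : ∀ s → Y ≢ c-label s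
        av≢c       : ∀ s → X ≢ c-label s
        c₀≢c₁      : c-label zero ≢ c-label (suc zero)

    module _ (valid : Valid) where
      open Valid valid

      b-below-top : ∀ (i : Fin (1 + n)) → o + toℕ i < 6 + n
      b-below-top i = <-≤-trans (s≤s (+-monoʳ-≤ o (≤-pred (toℕ<n i)))) o-room

      -- The b's lie strictly between 0 and k, so avoid the label of every d.
      b≢d : ∀ (i : Fin (1 + n)) s → o + toℕ i ≢ outer s extreme
      b≢d i low  = ≢-sym (<⇒≢ (≤-trans o-positive (m≤m+n o _)))
      b≢d i high = <⇒≢ (b-below-top i)

      b-distinct : ∀ {i j : Fin (1 + n)} → b {6 + n} i ≢ b j → o + toℕ i ≢ o + toℕ j
      b-distinct b≢b e = b≢b (cong b (toℕ-injective (+-cancelˡ-≡ o _ _ e)))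

      c-distinct : ∀ {i : Fin (1 + n)} (s s' : Fin 2) → hv {6 + n} i s hc ≢ hv i s' hc → c-label s ≢ c-label s'
      c-distinct zero       zero       c≢c = ⊥-elim (c≢c refl)
      c-distinct zero       (suc zero) _   = c₀≢c₁
      c-distinct (suc zero) zero       _   = ≢-sym c₀≢c₁
      c-distinct (suc zero) (suc zero) c≢c = ⊥-elim (c≢c refl)

      in-copy : ∀ {i s p q} → hv {6 + n} i s p ≢ hv i s q → p ≢ q
      in-copy hv≢hv refl = hv≢hv refl

      range : ∀ x → labelling x ≤ 6 + n
      range u          = ≤-refl
      range v          = ≤-refl
      range au         = Y-range
      range av         = X-range
      range (b i)      = <⇒≤ (b-below-top i)
      range (hv i s p) = gadget-range _ _ p

      far-edge : ∀ {x y} → E (6 + n) x y → Far (labelling x) (labelling y)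
      far-edge e-uau       = far-u-au
      far-edge e-auav      = far-au-av
      far-edge e-avv       = far-av-v
      far-edge (e-bau i)   = far-b-au i
      far-edge (e-bav i)   = far-b-av i
      far-edge (e-H i s h) = gadget-far _ _ h
      far-edge (e-bc i s)  = far-b-c i s

      far-adj : ∀ x y → Adj (6 + n) x y → Far (labelling x) (labelling y)
      far-adj x y (inj₁ xy) = far-edge xy
      far-adj x y (inj₂ yx) = far-sym (far-edge yx)

      distance-two : ∀ {x y z} → x ≢ y → ¬ Adj (6 + n) x y → Adj (6 + n) x z → Adj (6 + n) z y →
                     labelling x ≢ labelling y
      distance-two x≢y _ (inj₂ e-uau) (inj₁ e-uau) = ⊥-elim (x≢y refl)
      distance-two x≢y _ (inj₁ e-avv) (inj₂ e-avv) = ⊥-elim (x≢y refl)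
      distance-two x≢y _  (inj₁ e-uau)     (inj₂ e-uau)     = ⊥-elim (x≢y refl)
      distance-two _   _  (inj₁ e-uau)     (inj₁ e-auav)    = ≢-sym (far⇒≢ far-av-v)
      distance-two _   _  (inj₁ e-uau)     (inj₂ (e-bau j)) = ≢-sym (<⇒≢ (b-below-top j))
      distance-two _   _  (inj₂ e-auav)    (inj₂ e-uau)     = far⇒≢ far-av-v
      distance-two x≢y _  (inj₂ e-auav)    (inj₁ e-auav)    = ⊥-elim (x≢y refl)
      distance-two _   ¬a (inj₂ e-auav)    (inj₂ (e-bau j)) = ⊥-elim (¬a (inj₂ (e-bav j)))
      distance-two _   _  (inj₁ (e-bau i)) (inj₂ e-uau)     = <⇒≢ (b-below-top i)
      distance-two _   ¬a (inj₁ (e-bau i)) (inj₁ e-auav)    = ⊥-elim (¬a (inj₁ (e-bav i)))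
      distance-two x≢y _  (inj₁ (e-bau i)) (inj₂ (e-bau j)) = b-distinct x≢y
      distance-two x≢y _  (inj₁ e-auav)    (inj₂ e-auav)    = ⊥-elim (x≢y refl)
      distance-two _   _  (inj₁ e-auav)    (inj₁ e-avv)     = far⇒≢ (far-sym far-u-au)
      distance-two _   ¬a (inj₁ e-auav)    (inj₂ (e-bav j)) = ⊥-elim (¬a (inj₂ (e-bau j)))
      distance-two _   _  (inj₂ e-avv)     (inj₂ e-auav)    = far⇒≢ far-u-au
      distance-two x≢y _  (inj₂ e-avv)     (inj₁ e-avv)     = ⊥-elim (x≢y refl)
      distance-two _   _  (inj₂ e-avv)     (inj₂ (e-bav j)) = ≢-sym (<⇒≢ (b-below-top j))
      distance-two _   ¬a (inj₁ (e-bav i)) (inj₂ e-auav)    = ⊥-elim (¬a (inj₁ (e-bau i)))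
      distance-two _   _  (inj₁ (e-bav i)) (inj₁ e-avv)     = <⇒≢ (b-below-top i)
      distance-two x≢y _  (inj₁ (e-bav i)) (inj₂ (e-bav j)) = b-distinct x≢y
      distance-two x≢y _  (inj₂ (e-bau i)) (inj₁ (e-bau _))    = ⊥-elim (x≢y refl)
      distance-two _   ¬a (inj₂ (e-bau i)) (inj₁ (e-bav _))    = ⊥-elim (¬a (inj₁ e-auav))
      distance-two _   _  (inj₂ (e-bau i)) (inj₁ (e-bc _ s))   = au≢c s
      distance-two _   ¬a (inj₂ (e-bav i)) (inj₁ (e-bau _))    = ⊥-elim (¬a (inj₂ e-auav))
      distance-two x≢y _  (inj₂ (e-bav i)) (inj₁ (e-bav _))    = ⊥-elim (x≢y refl)
      distance-two _   _  (inj₂ (e-bav i)) (inj₁ (e-bc _ s))   = av≢c s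
      distance-two _   _  (inj₂ (e-bc i s)) (inj₁ (e-bau _))   = ≢-sym (au≢c s)
      distance-two _   _  (inj₂ (e-bc i s)) (inj₁ (e-bav _))   = ≢-sym (av≢c s)
      distance-two x≢y _  (inj₂ (e-bc i s)) (inj₁ (e-bc _ s')) = c-distinct s s' x≢y
      distance-two x≢y _  (inj₁ (e-bc i s)) (inj₂ (e-bc _ _))     = ⊥-elim (x≢y refl)
      distance-two _   _  (inj₁ (e-bc i s)) (inj₁ (e-H _ _ e-cd)) = b≢d i (side s)
      distance-two _   _  (inj₂ (e-H i s e-cd)) (inj₂ (e-bc _ _)) = ≢-sym (b≢d i (side s))
      distance-two x≢y _  (inj₁ (e-H i s h)) (inj₁ (e-H _ _ h')) = gadget-distinct _ _ (in-copy x≢y) (inj₁ h) (inj₁ h')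
      distance-two x≢y _  (inj₁ (e-H i s h)) (inj₂ (e-H _ _ h')) = gadget-distinct _ _ (in-copy x≢y) (inj₁ h) (inj₂ h')
      distance-two x≢y _  (inj₂ (e-H i s h)) (inj₁ (e-H _ _ h')) = gadget-distinct _ _ (in-copy x≢y) (inj₂ h) (inj₁ h')
      distance-two x≢y _  (inj₂ (e-H i s h)) (inj₂ (e-H _ _ h')) = gadget-distinct _ _ (in-copy x≢y) (inj₂ h) (inj₂ h')

      valid-labelling : IsL21 (6 + n) labelling
      valid-labelling = record
        { range = range
        ; adj   = far-adj
        ; dist2 = λ { x y (x≢y , ¬a , z , xz , zy) → distance-two x≢y ¬a xz zy }
        }

  -- a_v ↦ 2, a_u ↦ 0, b_i ↦ i + 4; the c's are labelled k and 1.
  realises-two-zero : Realises n 2 0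
  realises-two-zero = labelling , valid-labelling valid , refl , refl , refl , refl
    where
    side : Fin 2 → Side
    side zero    = low
    side (suc _) = high
    position : Fin 2 → Position
    position zero    = extreme
    position (suc _) = inner
    open Labelled 2 0 4 side position

    valid : Valid
    valid = record
      { X-range    = s≤s (s≤s z≤n)
      ; Y-range    = z≤n
      ; o-positive = s≤s z≤n
      ; o-room     = n≤1+n _
      ; far-u-au   = inj₂ (s≤s (s≤s z≤n))
      ; far-au-av  = inj₁ ≤-refl
      ; far-av-v   = inj₁ (s≤s (s≤s (s≤s (s≤s z≤n))))
      ; far-b-au   = λ _ → inj₂ (s≤s (s≤s z≤n))
      ; far-b-av   = λ i → inj₂ (m≤m+n 4 (toℕ i))
      ; far-b-c    = λ { i zero → inj₁ (+-monoʳ-≤ 6 (≤-pred (toℕ<n i)))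
                       ; i (suc zero) → inj₂ (s≤s (s≤s (s≤s z≤n))) }
      ; au≢c       = λ { zero () ; (suc zero) () }
      ; av≢c       = λ { zero () ; (suc zero) () }
      ; c₀≢c₁      = λ ()
      }

  -- a_v ↦ k - 2, a_u ↦ 0, b_i ↦ i + 2; the c's are labelled k and k - 1.
  realises-top-zero : Realises n (4 + n) 0
  realises-top-zero = labelling , valid-labelling valid , refl , refl , refl , refl
    where
    side : Fin 2 → Side
    side _ = low
    position : Fin 2 → Position
    position zero    = extreme
    position (suc _) = inner
    open Labelled (4 + n) 0 2 side position

    i≤n : ∀ (i : Fin (1 + n)) → toℕ i ≤ n
    i≤n i = ≤-pred (toℕ<n i)

    valid : Valid
    valid = record
      { X-range    = ≤-trans (n≤1+n _) (n≤1+n _)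
      ; Y-range    = z≤n
      ; o-positive = s≤s z≤n
      ; o-room     = +-monoˡ-≤ n (s≤s (s≤s (s≤s z≤n)))
      ; far-u-au   = inj₂ (s≤s (s≤s z≤n))
      ; far-au-av  = inj₁ (s≤s (s≤s z≤n))
      ; far-av-v   = inj₁ ≤-refl
      ; far-b-au   = λ i → inj₂ (m≤m+n 2 (toℕ i))
      ; far-b-av   = λ i → inj₁ (+-monoʳ-≤ 4 (i≤n i))
      ; far-b-c    = λ { i zero → inj₁ (+-monoʳ-≤ 4 (≤-trans (i≤n i) (m≤n+m n 2)))
                       ; i (suc zero) → inj₁ (+-monoʳ-≤ 4 (≤-trans (i≤n i) (n≤1+n n))) }
      ; au≢c       = λ { zero () ; (suc zero) () }
      ; av≢c       = λ { zero → <⇒≢ (n≤1+n _) ; (suc zero) → <⇒≢ ≤-refl }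
      ; c₀≢c₁      = ≢-sym (<⇒≢ ≤-refl)
      }

as-integers : ∀ {n X Y} → Realises n X Y →
  Σ (V (6 + n) → ℕ) (λ L → IsL21 (6 + n) L × L u ≡ 6 + n × L v ≡ 6 + n × + L av ≡ + X × + L au ≡ + Y)
as-integers (L , P , Lu , Lv , Lav , Lau) = L , P , Lu , Lv , cong +_ Lav , cong +_ Lau

as-pair : ∀ {a a' c c' : ℕ} → a ≡ a' → c ≡ c' → _≡_ {A = ℤ × ℤ} (+ a , + c) (+ a' , + c')
as-pair = cong₂ (λ a c → (+ a , + c))

lemma8 : (k : ℕ) → 6 ≤ k → (x y : ℤ) →
    (Σ (V k → ℕ) (λ L → IsL21 k L × L u ≡ k × L v ≡ k × + L av ≡ x × + L au ≡ y))
    ⇔ (((x , y) ≡ (+ 2 , + 0)) ⊎ ((x , y) ≡ (+ 0 , + 2)) ⊎ ((x , y) ≡ (+ (k ∸ 2) , + 0)) ⊎ ((x , y) ≡ (+ 0 , + (k ∸ 2))))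
lemma8 _ (s≤s (s≤s (s≤s (s≤s (s≤s (s≤s {n = n} z≤n)))))) x y = mk⇔ necessary sufficient
  where
  Labelled-xy : Set
  Labelled-xy = Σ (V (6 + n) → ℕ) (λ L → IsL21 (6 + n) L × L u ≡ 6 + n × L v ≡ 6 + n × + L av ≡ x × + L au ≡ y)

  Allowed-xy : Set
  Allowed-xy = ((x , y) ≡ (+ 2 , + 0)) ⊎ ((x , y) ≡ (+ 0 , + 2)) ⊎ ((x , y) ≡ (+ (4 + n) , + 0)) ⊎ ((x , y) ≡ (+ 0 , + (4 + n)))

  necessary : Labelled-xy → Allowed-xy
  necessary (L , P , Lu , Lv , refl , refl) with necessity n P Lu Lv
  ... | inj₁ (au≡0 , inj₁ av≡2)   = inj₁ (as-pair av≡2 au≡0)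
  ... | inj₂ (av≡0 , inj₁ au≡2)   = inj₂ (inj₁ (as-pair av≡0 au≡2))
  ... | inj₁ (au≡0 , inj₂ av≡k-2) = inj₂ (inj₂ (inj₁ (as-pair av≡k-2 au≡0)))
  ... | inj₂ (av≡0 , inj₂ au≡k-2) = inj₂ (inj₂ (inj₂ (as-pair av≡0 au≡k-2)))

  open Construction n using (realises-two-zero; realises-top-zero)

  sufficient : Allowed-xy → Labelled-xy
  sufficient (inj₁ refl)                = as-integers realises-two-zero
  sufficient (inj₂ (inj₁ refl))         = as-integers (realises-reflect realises-two-zero)
  sufficient (inj₂ (inj₂ (inj₁ refl)))  = as-integers realises-top-zero
  sufficient (inj₂ (inj₂ (inj₂ refl)))  = as-integers (realises-reflect realises-top-zero)
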